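{- Let $T$ be a tree and let $ab$, $cd$ be two non-incident edges of $T$ (so $a,b,c,d$ are distinct). The 2-switch $\tau=\binom{a\ b}{c\ d}$ is a t-switch over $T$ if and only if either the unique path in $T$ from $a$ to $d$ has the form $(a\,b\ldots c\,d)$ (i.e., its second vertex is $b$ and its penultimate vertex is $c$), or the unique path in $T$ from $b$ to $c$ has the form $(b\,a\ldots d\,c)$ (i.e., its second vertex is $a$ and its penultimate vertex is $d$).
   Context: Graphs are finite, simple, undirected and labeled. For vertices $a,b,c,d$ and a graph $G$, the matrix $\binom{a\ b}{c\ d}$ is interchangeable in $G$ if $ab,cd\in E(G)$, $\{a,b\}\cap\{c,d\}=\varnothing$ and $ac,bd\notin E(G)$; otherwise trivial. The 2-switch $\tau=\binom{a\ b}{c\ d}$ maps $G$ to $G-ab-cd+ac+bd$ if the matrix is interchangeable in $G$, and to $G$ otherwise; it is nontrivial for $G$ if the matrix is interchangeable in $G$. A nontrivial 2-switch $\tau$ over a tree $T$ is called a t-switch if $\tau(T)$ is a tree. -}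

module Defs where

open import Data.Nat using (ℕ)
open import Data.Fin using (Fin)
open import Data.List using (List; []; _∷_; _++_)
open import Data.Product using (Σ; ∃; _×_; _,_)
open import Data.Sum using (_⊎_)
open import Data.Empty using (⊥)
open import Relation.Nullary using (¬_)
open import Relation.Binary.PropositionalEquality using (_≡_)
open import Data.List.Relation.Unary.Linked using (Linked)
open import Data.List.Relation.Unary.Unique.Propositional using (Unique)

record Graph (n : ℕ) : Set₁ where
  field
    Adj    : Fin n → Fin n → Set
    sym    : ∀ {x y} → Adj x y → Adj y x
    irrefl : ∀ {x} → ¬ Adj x x
open Graph public

Rel : ℕ → Set₁
Rel n = Fin n → Fin n → Set

SameEdge : ∀ {n} → Fin n → Fin n → Fin n → Fin n → Set
SameEdge x y a b = (x ≡ a × y ≡ b) ⊎ (x ≡ b × y ≡ a)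

IsPath : ∀ {n} → Rel n → List (Fin n) → Set
IsPath R vs = Linked R vs × Unique vs

HasCycle : ∀ {n} → Rel n → Set
HasCycle {n} R =
  Σ (Fin n) λ u → Σ (Fin n) λ v → Σ (Fin n) λ w → Σ (List (Fin n)) λ mid →
    IsPath R (u ∷ v ∷ mid ++ w ∷ []) × R w u

Connected : ∀ {n} → Rel n → Set
Connected {n} R = ∀ (u v : Fin n) →
  u ≡ v ⊎ Σ (List (Fin n)) λ mid → IsPath R (u ∷ mid ++ v ∷ [])

IsTreeRel : ∀ {n} → Rel n → Set
IsTreeRel R = Connected R × ¬ HasCycle R

IsTree : ∀ {n} → Graph n → Set
IsTree G = IsTreeRel (Adj G)

Interchangeable : ∀ {n} → Graph n → Fin n → Fin n → Fin n → Fin n → Set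
Interchangeable G a b c d =
  Adj G a b × Adj G c d ×
  ¬ a ≡ c × ¬ a ≡ d × ¬ b ≡ c × ¬ b ≡ d ×
  ¬ Adj G a c × ¬ Adj G b d

switchAdj : ∀ {n} → Graph n → Fin n → Fin n → Fin n → Fin n → Rel n
switchAdj G a b c d x y =
  (Adj G x y × ¬ SameEdge x y a b × ¬ SameEdge x y c d)
  ⊎ SameEdge x y a c ⊎ SameEdge x y b d

IsTSwitch : ∀ {n} → Graph n → Fin n → Fin n → Fin n → Fin n → Set
IsTSwitch T a b c d = Interchangeable T a b c d × IsTreeRel (switchAdj T a b c d)

{-# OPTIONS --safe #-}
-- Removing an edge pq from a tree splits it in two; the side of a vertex x is whether the route
-- from x to q passes through p, and it is the same at both ends of every other edge of the tree.
--
-- If the route from a to d is a b … c d, its segment b … c survives the switch and links the ends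
-- of the removed edges ab and cd to those of the new edges ac and bd, so the switched graph is
-- connected. It is acyclic: ac is its only edge joining the two sides of ab, and bd its only edge
-- joining the two sides of dc; a cycle would have to cross each of them an even number of times,
-- but it passes through each at most once, so it would be a cycle of the tree. The case b a … d c
-- is the same switch with a, b and c, d interchanged.
--
-- Conversely, if the route from a to d contains b but not c, its segment b … d avoids a and c, so
-- it survives the switch and closes a cycle with the new edge bd; likewise for c without b. If the
-- route contains both, acyclicity makes them its second and penultimate vertices, and if it
-- contains neither, b a … d c is a path.

module Submission where

open import Defs hiding (sym)
open import Data.Nat using (ℕ)
open import Data.Fin using (Fin)
open import Data.Fin.Properties using (_≟_)
open import Data.Bool using (Bool; true; false)
open import Data.List using (List; []; _∷_; _++_)
open import Data.List.Properties using (++-assoc; ++-conicalʳ)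
open import Data.List.Relation.Unary.All using ([]; _∷_)
import Data.List.Relation.Unary.All.Properties as Allₚ
open import Data.List.Relation.Unary.All.Properties using (¬Any⇒All¬; All¬⇒¬Any)
open import Data.List.Relation.Unary.Any using (here; there)
open import Data.List.Relation.Unary.AllPairs using ([]; _∷_)
open import Data.List.Relation.Unary.Linked using (Linked; []; [-]; _∷_)
import Data.List.Relation.Unary.Linked as Linked
open import Data.List.Relation.Unary.Unique.Propositional using (Unique)
import Data.List.Relation.Unary.Unique.Propositional.Properties as Uniqueₚ
open import Data.List.Membership.Propositional using (_∈_; _∉_)
open import Data.List.Membership.Propositional.Properties
  using (∈-∃++; ∈-++⁻; ∈-++⁺ˡ; ∈-++⁺ʳ)
import Data.List.Membership.DecPropositional as DecMembership
open import Data.Product using (Σ; ∃; _×_; _,_; proj₁; proj₂)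
open import Data.Sum using (_⊎_; inj₁; inj₂; [_,_])
open import Data.Empty using (⊥-elim)
open import Function.Base using (_∘_)
open import Function.Bundles using (_⇔_; mk⇔)
open import Relation.Binary.Construct.Closure.ReflexiveTransitive
  using (Star; ε; _◅_; _◅◅_; _⋆)
import Relation.Binary.Construct.Closure.ReflexiveTransitive as Star
open import Relation.Binary.PropositionalEquality
  using (_≡_; _≢_; refl; sym; trans; cong; subst; module ≡-Reasoning)
open import Relation.Nullary using (¬_; Dec; yes; no; does)
open import Relation.Nullary.Decidable using (dec-true; dec-false; does-⇔; _×-dec_; _⊎-dec_)

module _ {A : Set} where

  data EndsAt (y : A) : List A → Set where
    here  : EndsAt y (y ∷ [])
    there : ∀ {x xs} → EndsAt y xs → EndsAt y (x ∷ xs)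

  EndsAt-∷ʳ : ∀ {y} xs → EndsAt y (xs ++ y ∷ [])
  EndsAt-∷ʳ []       = here
  EndsAt-∷ʳ (_ ∷ xs) = there (EndsAt-∷ʳ xs)

  EndsAt⇒∈ : ∀ {y xs} → EndsAt y xs → y ∈ xs
  EndsAt⇒∈ here      = here refl
  EndsAt⇒∈ (there e) = there (EndsAt⇒∈ e)

  EndsAt⇒∷ʳ : ∀ {y xs} → EndsAt y xs → ∃ λ init → xs ≡ init ++ y ∷ []
  EndsAt⇒∷ʳ here = [] , refl
  EndsAt⇒∷ʳ (there {x} e) with EndsAt⇒∷ʳ e
  ... | init , refl = x ∷ init , refl

  EndsAt-++⁻ʳ : ∀ {y} xs {z zs} → EndsAt y (xs ++ z ∷ zs) → EndsAt y (z ∷ zs)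
  EndsAt-++⁻ʳ []            e         = e
  EndsAt-++⁻ʳ (_ ∷ [])      (there e) = e
  EndsAt-++⁻ʳ (_ ∷ x ∷ xs)  (there e) = EndsAt-++⁻ʳ (x ∷ xs) e

  ∉-∷⁺ : ∀ {x y : A} {xs} → x ≢ y → x ∉ xs → x ∉ y ∷ xs
  ∉-∷⁺ x≢y _   (here x≡y) = x≢y x≡y
  ∉-∷⁺ _   x∉ (there x∈) = x∉ x∈

  ∉-++⁺ : ∀ {x : A} xs {ys} → x ∉ xs → x ∉ ys → x ∉ xs ++ ys
  ∉-++⁺ xs x∉xs x∉ys x∈ with ∈-++⁻ xs x∈
  ... | inj₁ x∈xs = x∉xs x∈xs
  ... | inj₂ x∈ys = x∉ys x∈ys

  Unique-++⁻ˡ : ∀ xs {ys : List A} → Unique (xs ++ ys) → Unique xs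
  Unique-++⁻ˡ []       _        = []
  Unique-++⁻ˡ (_ ∷ xs) (x∉ ∷ u) = Allₚ.++⁻ˡ xs x∉ ∷ Unique-++⁻ˡ xs u

  Unique-++⁻ʳ : ∀ xs {ys : List A} → Unique (xs ++ ys) → Unique ys
  Unique-++⁻ʳ []       u       = u
  Unique-++⁻ʳ (_ ∷ xs) (_ ∷ u) = Unique-++⁻ʳ xs u

  Unique-∷ʳ⁺ : ∀ {xs : List A} {z} → Unique xs → z ∉ xs → Unique (xs ++ z ∷ [])
  Unique-∷ʳ⁺ u z∉ = Uniqueₚ.++⁺ u ([] ∷ []) λ { (z∈ , here refl) → z∉ z∈ }

  Unique-∷ʳ⁻ : ∀ (xs : List A) {z} → Unique (xs ++ z ∷ []) → z ∉ xs
  Unique-∷ʳ⁻ (_ ∷ xs) (x∉ ∷ _) (here refl) = All¬⇒¬Any x∉ (∈-++⁺ʳ xs (here refl))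
  Unique-∷ʳ⁻ (_ ∷ xs) (_ ∷ u)  (there z∈)  = Unique-∷ʳ⁻ xs u z∈

  MissesAnEnd : A → A → List A → Set
  MissesAnEnd p q xs = p ∉ xs ⊎ q ∉ xs

  MissesAnEnd-tail : ∀ {p q x : A} {xs} → MissesAnEnd p q (x ∷ xs) → MissesAnEnd p q xs
  MissesAnEnd-tail (inj₁ p∉) = inj₁ (p∉ ∘ there)
  MissesAnEnd-tail (inj₂ q∉) = inj₂ (q∉ ∘ there)

module _ {n : ℕ} where

  SameEdge-swap : ∀ {x y p q : Fin n} → SameEdge x y p q → SameEdge y x p q
  SameEdge-swap (inj₁ (x≡p , y≡q)) = inj₂ (y≡q , x≡p)
  SameEdge-swap (inj₂ (x≡q , y≡p)) = inj₁ (y≡p , x≡q)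

  SameEdge-flip : ∀ {x y p q : Fin n} → SameEdge x y p q → SameEdge x y q p
  SameEdge-flip (inj₁ e) = inj₂ e
  SameEdge-flip (inj₂ e) = inj₁ e

  MissesAnEnd⇒¬SameEdge : ∀ {x y p q : Fin n} {xs} → MissesAnEnd p q (x ∷ y ∷ xs) → ¬ SameEdge x y p q
  MissesAnEnd⇒¬SameEdge (inj₁ p∉) (inj₁ (refl , refl)) = p∉ (here refl)
  MissesAnEnd⇒¬SameEdge (inj₂ q∉) (inj₁ (refl , refl)) = q∉ (there (here refl))
  MissesAnEnd⇒¬SameEdge (inj₁ p∉) (inj₂ (refl , refl)) = p∉ (there (here refl))
  MissesAnEnd⇒¬SameEdge (inj₂ q∉) (inj₂ (refl , refl)) = q∉ (here refl)

  endpoint∉⇒MissesAnEnd : ∀ {x y p q : Fin n} {xs} → SameEdge x y p q → x ∉ xs → MissesAnEnd p q xs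
  endpoint∉⇒MissesAnEnd (inj₁ (refl , _)) x∉ = inj₁ x∉
  endpoint∉⇒MissesAnEnd (inj₂ (refl , _)) x∉ = inj₂ x∉

  SameEdge-other-end : ∀ {u v w p q : Fin n} → p ≢ q →
                       SameEdge w u p q → SameEdge u v p q → v ≡ w
  SameEdge-other-end p≢q (inj₁ (refl , refl)) (inj₁ (refl , refl)) = ⊥-elim (p≢q refl)
  SameEdge-other-end p≢q (inj₁ (refl , refl)) (inj₂ (refl , refl)) = refl
  SameEdge-other-end p≢q (inj₂ (refl , refl)) (inj₁ (refl , refl)) = refl
  SameEdge-other-end p≢q (inj₂ (refl , refl)) (inj₂ (refl , refl)) = ⊥-elim (p≢q refl)

SameEdge? : ∀ {n} (x y p q : Fin n) → Dec (SameEdge x y p q)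
SameEdge? x y p q = ((x ≟ p) ×-dec (y ≟ q)) ⊎-dec ((x ≟ q) ×-dec (y ≟ p))

module _ {A : Set} {R : A → A → Set} where

  Linked-++⁻ˡ : ∀ xs {ys} → Linked R (xs ++ ys) → Linked R xs
  Linked-++⁻ˡ []           _        = []
  Linked-++⁻ˡ (_ ∷ [])     _        = [-]
  Linked-++⁻ˡ (_ ∷ y ∷ xs) (r ∷ rs) = r ∷ Linked-++⁻ˡ (y ∷ xs) rs

  Linked-++⁻ʳ : ∀ xs {ys} → Linked R (xs ++ ys) → Linked R ys
  Linked-++⁻ʳ []       rs = rs
  Linked-++⁻ʳ (_ ∷ xs) rs = Linked-++⁻ʳ xs (Linked.tail rs)

  Linked-∷ʳ⁺ : ∀ xs {y z} → Linked R (xs ++ y ∷ []) → R y z → Linked R (xs ++ y ∷ z ∷ [])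
  Linked-∷ʳ⁺ []           _        r = r ∷ [-]
  Linked-∷ʳ⁺ (_ ∷ [])     (r′ ∷ _) r = r′ ∷ r ∷ [-]
  Linked-∷ʳ⁺ (_ ∷ x ∷ xs) (r′ ∷ rs) r = r′ ∷ Linked-∷ʳ⁺ (x ∷ xs) rs r

module _ {n : ℕ} {R : Rel n} where

  IsPath-++⁻ˡ : ∀ xs {ys} → IsPath R (xs ++ ys) → IsPath R xs
  IsPath-++⁻ˡ xs (l , u) = Linked-++⁻ˡ xs l , Unique-++⁻ˡ xs u

  IsPath-++⁻ʳ : ∀ xs {ys} → IsPath R (xs ++ ys) → IsPath R ys
  IsPath-++⁻ʳ xs (l , u) = Linked-++⁻ʳ xs l , Unique-++⁻ʳ xs u

  IsPath-∷ʳ-prefix : ∀ xs {y zs} → IsPath R (xs ++ y ∷ zs) → IsPath R (xs ++ y ∷ [])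
  IsPath-∷ʳ-prefix xs {y} {zs} p =
    IsPath-++⁻ˡ (xs ++ y ∷ []) (subst (IsPath R) (sym (++-assoc xs (y ∷ []) zs)) p)

  IsPath-∷⁺ : ∀ {x y ys} → R x y → x ∉ y ∷ ys → IsPath R (y ∷ ys) → IsPath R (x ∷ y ∷ ys)
  IsPath-∷⁺ xy x∉ (l , u) = xy ∷ l , ¬Any⇒All¬ _ x∉ ∷ u

  IsPath-∷ʳ⁺ : ∀ xs {y z} → IsPath R (xs ++ y ∷ []) → R y z → z ∉ xs ++ y ∷ [] →
               IsPath R (xs ++ y ∷ z ∷ [])
  IsPath-∷ʳ⁺ xs {y} {z} (l , u) yz z∉ =
    Linked-∷ʳ⁺ xs l yz , subst Unique (++-assoc xs (y ∷ []) (z ∷ [])) (Unique-∷ʳ⁺ u z∉)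

IsRoute : ∀ {n} → Rel n → Fin n → Fin n → List (Fin n) → Set
IsRoute R x y L = IsPath R (x ∷ L) × EndsAt y (x ∷ L)

Route : ∀ {n} → Rel n → Fin n → Fin n → Set
Route {n} R x y = Σ (List (Fin n)) (IsRoute R x y)

Connection : ∀ {n} → Rel n → Fin n → Fin n → Set
Connection {n} R x y = x ≡ y ⊎ Σ (List (Fin n)) λ mid → IsPath R (x ∷ mid ++ y ∷ [])

module _ {n : ℕ} {R : Rel n} where
  open DecMembership (_≟_ {n}) using (_∈?_)

  route-refl : ∀ {x} → Route R x x
  route-refl = [] , ([-] , [] ∷ []) , here

  route-tail : ∀ {x y z L} → IsRoute R x z (y ∷ L) → IsRoute R y z L
  route-tail ((_ ∷ l , _ ∷ u) , there e) = (l , u) , e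

  route-head∉ : ∀ {x z L} → IsRoute R x z L → x ∉ L
  route-head∉ ((_ , x∉ ∷ _) , _) = All¬⇒¬Any x∉

  connection⇒route : ∀ {x y} → Connection R x y → Route R x y
  connection⇒route (inj₁ refl)            = route-refl
  connection⇒route {y = y} (inj₂ (mid , p)) = mid ++ y ∷ [] , p , there (EndsAt-∷ʳ mid)

  route⇒connection : ∀ {x y} → Route R x y → Connection R x y
  route⇒connection ([] , _ , here)      = inj₁ refl
  route⇒connection ([] , _ , there ())
  route⇒connection {x} (_ ∷ L , p , there e) with EndsAt⇒∷ʳ e
  ... | mid , L≡ = inj₂ (mid , subst (λ K → IsPath R (x ∷ K)) L≡ p)

  linked⇒walk : ∀ {x y} L → Linked R (x ∷ L) → EndsAt y (x ∷ L) → Star R x y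
  linked⇒walk []      _        here      = ε
  linked⇒walk []      _        (there ())
  linked⇒walk (_ ∷ L) (xz ∷ l) (there e) = xz ◅ linked⇒walk L l e

  route⇒walk : ∀ {x y} → Route R x y → Star R x y
  route⇒walk (L , (l , _) , e) = linked⇒walk L l e

  suffix-route : ∀ {x y L} → x ∈ L → IsPath R L → EndsAt y L → Route R x y
  suffix-route x∈ p e with ∈-∃++ x∈
  ... | ys , zs , refl = zs , IsPath-++⁻ʳ ys p , EndsAt-++⁻ʳ ys e

  walk⇒route : ∀ {x y} → Star R x y → Route R x y
  walk⇒route ε = route-refl
  walk⇒route {x} (_◅_ {j = z} xz w) with walk⇒route w
  ... | L , (l , u) , e with x ∈? (z ∷ L)
  ...   | no x∉  = z ∷ L , IsPath-∷⁺ xz x∉ (l , u) , there e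
  ...   | yes x∈ = suffix-route x∈ (l , u) e

module Acyclic {n : ℕ} {R : Rel n} (acyclic : ¬ HasCycle R) where

  closed-path⇒no-interior : ∀ {x y} mid → IsPath R (x ∷ mid ++ y ∷ []) → R y x → mid ≡ []
  closed-path⇒no-interior []        _ _  = refl
  closed-path⇒no-interior (v ∷ mid) p yx = ⊥-elim (acyclic (_ , v , _ , mid , p , yx))

  neighbour-on-path-is-next : ∀ {x y} L → IsPath R (x ∷ L) → R y x → y ∈ L →
                              ∃ λ L′ → L ≡ y ∷ L′
  neighbour-on-path-is-next {x} L p yx y∈ with ∈-∃++ y∈
  ... | ys , zs , refl with closed-path⇒no-interior ys (IsPath-∷ʳ-prefix (x ∷ ys) p) yx
  ...   | refl = zs , refl

  neighbour-on-path-is-penultimate : ∀ {x y z} L → IsPath R (x ∷ L ++ z ∷ []) → R z y →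
                                     y ∈ L → ∃ λ L′ → L ≡ L′ ++ y ∷ []
  neighbour-on-path-is-penultimate {x} {y} {z} L p zy y∈ with ∈-∃++ y∈
  ... | ys , zs , refl with closed-path⇒no-interior zs (IsPath-++⁻ʳ (x ∷ ys) p′) zy
    where
      p′ : IsPath R (x ∷ ys ++ y ∷ zs ++ z ∷ [])
      p′ = subst (λ K → IsPath R (x ∷ K)) (++-assoc ys (y ∷ zs) (z ∷ [])) p
  ...   | refl = ys , refl

module CutEdge {n : ℕ} {S : Rel n} (φ : Fin n → Bool) {p q : Fin n}
               (step : ∀ {x y} → S x y → φ x ≡ φ y ⊎ SameEdge x y p q) where

  φ-constant-on-paths-missing-an-end : ∀ {x y} L → Linked S (x ∷ L) → EndsAt y (x ∷ L) →
                                MissesAnEnd p q (x ∷ L) → φ x ≡ φ y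
  φ-constant-on-paths-missing-an-end []      _        here      _      = refl
  φ-constant-on-paths-missing-an-end []      _        (there ()) _
  φ-constant-on-paths-missing-an-end (_ ∷ L) (xz ∷ l) (there e) misses with step xz
  ... | inj₁ φx≡φz = trans φx≡φz (φ-constant-on-paths-missing-an-end L l e (MissesAnEnd-tail misses))
  ... | inj₂ xz-pq = ⊥-elim (MissesAnEnd⇒¬SameEdge misses xz-pq)

  module _ (φp≢φq : φ p ≢ φ q) where

    SameEdge⇒φ≢ : ∀ {x y} → SameEdge x y p q → φ x ≢ φ y
    SameEdge⇒φ≢ (inj₁ (refl , refl)) = φp≢φq
    SameEdge⇒φ≢ (inj₂ (refl , refl)) = φp≢φq ∘ sym

    route-leaving-by-edge⇒φ≢ : ∀ {x y z} L → IsRoute S x y (z ∷ L) → SameEdge x z p q →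
                               φ x ≢ φ y
    route-leaving-by-edge⇒φ≢ {z = z} L r@((_ ∷ l , _) , there e) xz-pq φx≡φy =
      SameEdge⇒φ≢ xz-pq (trans φx≡φy (sym (φ-constant-on-paths-missing-an-end L l e misses)))
      where
        misses : MissesAnEnd p q (z ∷ L)
        misses = endpoint∉⇒MissesAnEnd xz-pq (route-head∉ r)

    no-cycle-closed-by-edge : ∀ {u v w} mid → IsPath S (u ∷ v ∷ mid ++ w ∷ []) →
                              ¬ SameEdge w u p q
    no-cycle-closed-by-edge {u} {v} {w} mid (uv ∷ l , u∉ ∷ v∉ ∷ _) wu-pq with step uv
    ... | inj₁ φu≡φv = SameEdge⇒φ≢ wu-pq (sym (trans φu≡φv φv≡φw))
      where
        misses : MissesAnEnd p q (v ∷ mid ++ w ∷ [])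
        misses = endpoint∉⇒MissesAnEnd (SameEdge-swap wu-pq) (All¬⇒¬Any u∉)
        φv≡φw : φ v ≡ φ w
        φv≡φw = φ-constant-on-paths-missing-an-end (mid ++ w ∷ []) l (there (EndsAt-∷ʳ mid)) misses
    ... | inj₂ uv-pq = All¬⇒¬Any v∉ (subst (_∈ mid ++ w ∷ []) (sym v≡w) (∈-++⁺ʳ mid (here refl)))
      where
        v≡w : v ≡ w
        v≡w = SameEdge-other-end (φp≢φq ∘ cong φ) wu-pq uv-pq

module Tree {n : ℕ} (T : Graph n) (tree : IsTree T) where
  open Acyclic (proj₂ tree)
  open DecMembership (_≟_ {n}) using (_∈?_)

  route-unique : ∀ {x y} L₁ L₂ → IsRoute (Adj T) x y L₁ → IsRoute (Adj T) x y L₂ → L₁ ≡ L₂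
  route-unique []      []      _                 _                 = refl
  route-unique []      (_ ∷ _) (_ , here)        r₂@(_ , there e₂) = ⊥-elim (route-head∉ r₂ (EndsAt⇒∈ e₂))
  route-unique []      (_ ∷ _) (_ , there ())    _
  route-unique (_ ∷ _) []      r₁@(_ , there e₁) (_ , here)        = ⊥-elim (route-head∉ r₁ (EndsAt⇒∈ e₁))
  route-unique (_ ∷ _) []      _                 (_ , there ())
  route-unique {x} (p ∷ L₁) (q ∷ L₂) r₁@((xp ∷ l₁ , u₁) , e₁) r₂@((xq ∷ _ , _) , _)
    with q ∈? (p ∷ L₁)
  ... | yes q∈ with neighbour-on-path-is-next (p ∷ L₁) (proj₁ r₁) (Graph.sym T xq) q∈
  ...   | _ , refl = cong (q ∷_) (route-unique L₁ L₂ (route-tail r₁) (route-tail r₂))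
  route-unique {x} (p ∷ L₁) (q ∷ L₂) r₁@((xp ∷ l₁ , u₁) , e₁) r₂@((xq ∷ _ , _) , _)
    | no q∉ = ⊥-elim (route-head∉ r₂ (there (subst (x ∈_) x∷p∷L₁≡L₂ (here refl))))
    where
      q≢x : q ≢ x
      q≢x q≡x = route-head∉ r₂ (here (sym q≡x))

      -- q, x, p, … is a second route from q, so it is the given one.
      x∷p∷L₁≡L₂ : x ∷ p ∷ L₁ ≡ L₂
      x∷p∷L₁≡L₂ = route-unique (x ∷ p ∷ L₁) L₂
        (IsPath-∷⁺ (Graph.sym T xq) (∉-∷⁺ q≢x q∉) (xp ∷ l₁ , u₁) , there e₁) (route-tail r₂)

  module EdgeSide {p q : Fin n} (pq : Adj T p q) where

    route-to-q : ∀ x → Route (Adj T) x q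
    route-to-q x = connection⇒route (proj₁ tree x q)

    side : Fin n → Bool
    side x = does (p ∈? (x ∷ proj₁ (route-to-q x)))

    side-by-route : ∀ {x L} → IsRoute (Adj T) x q L → side x ≡ does (p ∈? (x ∷ L))
    side-by-route {x} r =
      cong (λ L → does (p ∈? (x ∷ L))) (route-unique _ _ (proj₂ (route-to-q x)) r)

    p≢q : p ≢ q
    p≢q refl = Graph.irrefl T pq

    edge-route : IsRoute (Adj T) p q (q ∷ [])
    edge-route = IsPath-∷⁺ pq (∉-∷⁺ p≢q λ ()) ([-] , [] ∷ []) , there here

    side-p : side p ≡ true
    side-p = dec-true (p ∈? (p ∷ proj₁ (route-to-q p))) (here refl)

    side-q : side q ≡ false
    side-q =
      trans (side-by-route (proj₂ route-refl)) (dec-false (p ∈? (q ∷ [])) (∉-∷⁺ p≢q λ ()))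

    side-extend : ∀ {x y L} → IsRoute (Adj T) x q L → Adj T y x → y ∉ x ∷ L →
                  ¬ SameEdge x y p q → side x ≡ side y
    side-extend {x} {y} {L} r@(path , e) yx y∉ ¬xy-pq = begin
      side x                  ≡⟨ side-by-route r ⟩
      does (p ∈? (x ∷ L))     ≡⟨ does-⇔ (mk⇔ there from-y) (p ∈? (x ∷ L)) (p ∈? (y ∷ x ∷ L)) ⟩
      does (p ∈? (y ∷ x ∷ L)) ≡⟨ sym (side-by-route r′) ⟩
      side y                  ∎
      where
        open ≡-Reasoning
        r′ : IsRoute (Adj T) y q (x ∷ L)
        r′ = IsPath-∷⁺ yx y∉ path , there e

        p≢y : p ≢ y
        p≢y refl with route-unique (x ∷ L) (q ∷ []) r′ edge-route
        ... | refl = ¬xy-pq (inj₂ (refl , refl))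

        from-y : p ∈ y ∷ x ∷ L → p ∈ x ∷ L
        from-y (here p≡y) = ⊥-elim (p≢y p≡y)
        from-y (there p∈) = p∈

    side-edge : ∀ {x y} → Adj T x y → ¬ SameEdge x y p q → side x ≡ side y
    side-edge xy = side-edge-via (proj₂ (route-to-q _)) xy
      where
        side-edge-via : ∀ {x y L} → IsRoute (Adj T) x q L → Adj T x y → ¬ SameEdge x y p q →
                        side x ≡ side y
        side-edge-via {x} {y} {L} r xy ¬xy-pq with y ∈? (x ∷ L)
        ... | no y∉ = side-extend r (Graph.sym T xy) y∉ ¬xy-pq
        ... | yes (here refl) = ⊥-elim (Graph.irrefl T xy)
        ... | yes (there y∈) with neighbour-on-path-is-next L (proj₁ r) (Graph.sym T xy) y∈
        ...   | _ , refl =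
          sym (side-extend (route-tail r) xy (route-head∉ r) (¬xy-pq ∘ SameEdge-swap))

    side-step : ∀ {x y} → Adj T x y → side x ≡ side y ⊎ SameEdge x y p q
    side-step {x} {y} xy with SameEdge? x y p q
    ... | yes xy-pq = inj₂ xy-pq
    ... | no ¬xy-pq = inj₁ (side-edge xy ¬xy-pq)

module Switch {n : ℕ} (T : Graph n) (a b c d : Fin n) where

  switchAdj-sym : ∀ {x y} → switchAdj T a b c d x y → switchAdj T a b c d y x
  switchAdj-sym (inj₁ (xy , ¬ab , ¬cd)) =
    inj₁ (Graph.sym T xy , ¬ab ∘ SameEdge-swap , ¬cd ∘ SameEdge-swap)
  switchAdj-sym (inj₂ (inj₁ ac)) = inj₂ (inj₁ (SameEdge-swap ac))
  switchAdj-sym (inj₂ (inj₂ bd)) = inj₂ (inj₂ (SameEdge-swap bd))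

  Linked-switch⁺ : ∀ L → MissesAnEnd a b L → MissesAnEnd c d L →
                   Linked (Adj T) L → Linked (switchAdj T a b c d) L
  Linked-switch⁺ []          _   _   _        = []
  Linked-switch⁺ (_ ∷ [])    _   _   _        = [-]
  Linked-switch⁺ (_ ∷ y ∷ L) mab mcd (xy ∷ l) =
    inj₁ (xy , MissesAnEnd⇒¬SameEdge mab , MissesAnEnd⇒¬SameEdge mcd)
    ∷ Linked-switch⁺ (y ∷ L) (MissesAnEnd-tail mab) (MissesAnEnd-tail mcd) l

switchAdj-flip : ∀ {n} (T : Graph n) (a b c d : Fin n) {x y} →
                 switchAdj T b a d c x y → switchAdj T a b c d x y
switchAdj-flip T a b c d (inj₁ (xy , ¬ba , ¬dc)) =
  inj₁ (xy , ¬ba ∘ SameEdge-flip , ¬dc ∘ SameEdge-flip)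
switchAdj-flip T a b c d (inj₂ (inj₁ bd)) = inj₂ (inj₂ bd)
switchAdj-flip T a b c d (inj₂ (inj₂ ac)) = inj₂ (inj₁ ac)

IsTreeRel-resp : ∀ {n} {R₁ R₂ : Rel n} →
                 (∀ {x y} → R₁ x y → R₂ x y) → (∀ {x y} → R₂ x y → R₁ x y) →
                 IsTreeRel R₁ → IsTreeRel R₂
IsTreeRel-resp {R₂ = R₂} to from (connected , acyclic) = connected′ , acyclic′
  where
    connected′ : Connected R₂
    connected′ u v with connected u v
    ... | inj₁ u≡v               = inj₁ u≡v
    ... | inj₂ (mid , (l , uniq)) = inj₂ (mid , Linked.map to l , uniq)

    acyclic′ : ¬ HasCycle R₂
    acyclic′ (u , v , w , mid , (l , uniq) , wu) =
      acyclic (u , v , w , mid , (Linked.map from l , uniq) , from wu)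

-- τ (a b / c d) and τ (b a / d c) are the same 2-switch.
IsTSwitch-flip : ∀ {n} (T : Graph n) (a b c d : Fin n) →
                 IsTSwitch T b a d c → IsTSwitch T a b c d
IsTSwitch-flip T a b c d ((ba , dc , b≢d , b≢c , a≢d , a≢c , ¬bd , ¬ac) , tree) =
  (Graph.sym T ba , Graph.sym T dc , a≢c , a≢d , b≢c , b≢d , ¬ac , ¬bd) ,
  IsTreeRel-resp (switchAdj-flip T a b c d) (switchAdj-flip T b a d c) tree

Aligned : ∀ {n} → Graph n → (a b c d : Fin n) → Set
Aligned {n} T a b c d =
  (Σ (List (Fin n)) λ mid → IsPath (Adj T) (a ∷ b ∷ mid ++ c ∷ d ∷ []))
  ⊎ (Σ (List (Fin n)) λ mid → IsPath (Adj T) (b ∷ a ∷ mid ++ d ∷ c ∷ []))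

module SwitchAlongAlignedRoute {n : ℕ} (T : Graph n) (tree : IsTree T) {a b c d : Fin n}
  (ab : Adj T a b) (cd : Adj T c d) (a≢c : a ≢ c) (a≢d : a ≢ d) (b≢c : b ≢ c) (b≢d : b ≢ d)
  (mid : List (Fin n)) (aligned : IsPath (Adj T) (a ∷ b ∷ mid ++ c ∷ d ∷ [])) where

  open Tree T tree
  open Acyclic (proj₂ tree)
  open Switch T a b c d

  S : Rel n
  S = switchAdj T a b c d

  -- b ∷ inner is the segment b … c, which the switch keeps.
  inner : List (Fin n)
  inner = mid ++ c ∷ []

  route′ : IsPath (Adj T) (a ∷ (b ∷ inner) ++ d ∷ [])
  route′ = subst (λ K → IsPath (Adj T) (a ∷ b ∷ K)) (sym (++-assoc mid (c ∷ []) (d ∷ []))) aligned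

  inner-path : IsPath (Adj T) (b ∷ inner)
  inner-path = IsPath-++⁻ˡ (b ∷ inner) (IsPath-++⁻ʳ (a ∷ []) route′)

  inner-ends : EndsAt c (b ∷ inner)
  inner-ends = there (EndsAt-∷ʳ mid)

  a∉inner : a ∉ b ∷ inner
  a∉inner a∈ = Uniqueₚ.Unique[x∷xs]⇒x∉xs (proj₂ route′) (∈-++⁺ˡ a∈)

  d∉inner : d ∉ b ∷ inner
  d∉inner = Unique-∷ʳ⁻ (b ∷ inner) (proj₂ (IsPath-++⁻ʳ (a ∷ []) route′))

  ¬ac : ¬ Adj T a c
  ¬ac ac
    with closed-path⇒no-interior (b ∷ mid) (IsPath-++⁻ˡ (a ∷ b ∷ inner) route′) (Graph.sym T ac)
  ... | ()

  ¬bd : ¬ Adj T b d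
  ¬bd bd with ++-conicalʳ mid (c ∷ [])
                (closed-path⇒no-interior inner (IsPath-++⁻ʳ (a ∷ []) route′) (Graph.sym T bd))
  ... | ()

  module F = EdgeSide ab
  module G = EdgeSide (Graph.sym T cd)

  f g : Fin n → Bool
  f = F.side
  g = G.side

  f-b : f b ≡ false
  f-b = F.side-q

  f-c : f c ≡ false
  f-c = trans (sym f-b≡f-c) f-b
    where
      f-b≡f-c : f b ≡ f c
      f-b≡f-c = CutEdge.φ-constant-on-paths-missing-an-end f F.side-step inner (proj₁ inner-path)
                  inner-ends (inj₁ a∉inner)

  f-d : f d ≡ false
  f-d = trans (sym (F.side-edge cd [ a≢c ∘ sym ∘ proj₁ , b≢c ∘ sym ∘ proj₁ ])) f-c

  g-c : g c ≡ false
  g-c = G.side-q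

  g-b : g b ≡ false
  g-b = trans g-b≡g-c g-c
    where
      g-b≡g-c : g b ≡ g c
      g-b≡g-c = CutEdge.φ-constant-on-paths-missing-an-end g G.side-step inner (proj₁ inner-path)
                  inner-ends (inj₁ d∉inner)

  g-a : g a ≡ false
  g-a = trans (G.side-edge ab [ a≢d ∘ proj₁ , a≢c ∘ proj₁ ]) g-b

  f-a≢f-c : f a ≢ f c
  f-a≢f-c fa≡fc with trans (sym F.side-p) (trans fa≡fc f-c)
  ... | ()

  g-b≢g-d : g b ≢ g d
  g-b≢g-d gb≡gd with trans (sym g-b) (trans gb≡gd G.side-p)
  ... | ()

  f-step : ∀ {x y} → S x y → f x ≡ f y ⊎ SameEdge x y a c
  f-step (inj₁ (xy , ¬ab , _))               = inj₁ (F.side-edge xy ¬ab)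
  f-step (inj₂ (inj₁ ac))                    = inj₂ ac
  f-step (inj₂ (inj₂ (inj₁ (refl , refl)))) = inj₁ (trans f-b (sym f-d))
  f-step (inj₂ (inj₂ (inj₂ (refl , refl)))) = inj₁ (trans f-d (sym f-b))

  g-step : ∀ {x y} → S x y → g x ≡ g y ⊎ SameEdge x y b d
  g-step (inj₁ (xy , _ , ¬cd))               = inj₁ (G.side-edge xy (¬cd ∘ SameEdge-flip))
  g-step (inj₂ (inj₁ (inj₁ (refl , refl)))) = inj₁ (trans g-a (sym g-c))
  g-step (inj₂ (inj₁ (inj₂ (refl , refl)))) = inj₁ (trans g-c (sym g-a))
  g-step (inj₂ (inj₂ bd))                    = inj₂ bd

  module FS = CutEdge f f-step
  module GS = CutEdge g g-step

  route-within-sides⇒Linked-T : ∀ {x y} L → IsRoute S x y L → f x ≡ f y → g x ≡ g y →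
                                Linked (Adj T) (x ∷ L)
  route-within-sides⇒Linked-T []      _ _ _ = [-]
  route-within-sides⇒Linked-T (_ ∷ L) r@((inj₁ (xz , ¬ab , ¬cd) ∷ _ , _) , _) fx≡fy gx≡gy =
    xz ∷ route-within-sides⇒Linked-T L (route-tail r)
           (trans (sym (F.side-edge xz ¬ab)) fx≡fy)
           (trans (sym (G.side-edge xz (¬cd ∘ SameEdge-flip))) gx≡gy)
  route-within-sides⇒Linked-T (_ ∷ L) r@((inj₂ (inj₁ ac) ∷ _ , _) , _) fx≡fy _ =
    ⊥-elim (FS.route-leaving-by-edge⇒φ≢ f-a≢f-c L r ac fx≡fy)
  route-within-sides⇒Linked-T (_ ∷ L) r@((inj₂ (inj₂ bd) ∷ _ , _) , _) _ gx≡gy =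
    ⊥-elim (GS.route-leaving-by-edge⇒φ≢ g-b≢g-d L r bd gx≡gy)

  switch-acyclic : ¬ HasCycle S
  switch-acyclic (u , v , w , mid′ , cycle@(_ , uniq) , inj₁ (wu , ¬ab , ¬cd)) =
    proj₂ tree (u , v , w , mid′ , (T-path , uniq) , wu)
    where
      T-path : Linked (Adj T) (u ∷ v ∷ mid′ ++ w ∷ [])
      T-path = route-within-sides⇒Linked-T (v ∷ mid′ ++ w ∷ [])
                 (cycle , there (there (EndsAt-∷ʳ mid′)))
                 (sym (F.side-edge wu ¬ab)) (sym (G.side-edge wu (¬cd ∘ SameEdge-flip)))
  switch-acyclic (_ , _ , _ , mid′ , cycle , inj₂ (inj₁ ac)) =
    FS.no-cycle-closed-by-edge f-a≢f-c mid′ cycle ac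
  switch-acyclic (_ , _ , _ , mid′ , cycle , inj₂ (inj₂ bd)) =
    GS.no-cycle-closed-by-edge g-b≢g-d mid′ cycle bd

  inner-walk : Star S b c
  inner-walk = linked⇒walk inner
    (Linked-switch⁺ (b ∷ inner) (inj₁ a∉inner) (inj₂ d∉inner) (proj₁ inner-path)) inner-ends

  inner-walk⁻¹ : Star S c b
  inner-walk⁻¹ = Star.reverse switchAdj-sym inner-walk

  new-ac : S a c
  new-ac = inj₂ (inj₁ (inj₁ (refl , refl)))

  new-bd : S b d
  new-bd = inj₂ (inj₂ (inj₁ (refl , refl)))

  edge-walk : ∀ {x y} → Adj T x y → Star S x y
  edge-walk {x} {y} xy with SameEdge? x y a b | SameEdge? x y c d
  ... | yes (inj₁ (refl , refl)) | _                        = new-ac ◅ inner-walk⁻¹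
  ... | yes (inj₂ (refl , refl)) | _                        = inner-walk ◅◅ (switchAdj-sym new-ac ◅ ε)
  ... | no _                     | yes (inj₁ (refl , refl)) = inner-walk⁻¹ ◅◅ (new-bd ◅ ε)
  ... | no _                     | yes (inj₂ (refl , refl)) = switchAdj-sym new-bd ◅ inner-walk
  ... | no ¬ab                   | no ¬cd                   = inj₁ (xy , ¬ab , ¬cd) ◅ ε

  switch-connected : Connected S
  switch-connected u v = route⇒connection (walk⇒route ((edge-walk ⋆) T-walk))
    where
      T-walk : Star (Adj T) u v
      T-walk = route⇒walk (connection⇒route (proj₁ tree u v))

  is-t-switch : IsTSwitch T a b c d
  is-t-switch = (ab , cd , a≢c , a≢d , b≢c , b≢d , ¬ac , ¬bd) , switch-connected , switch-acyclic

module AlignedFromAcyclicSwitch {n : ℕ} (T : Graph n) (tree : IsTree T) {a b c d : Fin n}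
  (ab : Adj T a b) (cd : Adj T c d) (a≢c : a ≢ c) (a≢d : a ≢ d) (b≢c : b ≢ c) (b≢d : b ≢ d)
  (¬ac : ¬ Adj T a c) (¬bd : ¬ Adj T b d) (switch-acyclic : ¬ HasCycle (switchAdj T a b c d)) where

  open Acyclic (proj₂ tree)
  open Switch T a b c d
  open DecMembership (_≟_ {n}) using (_∈?_)

  -- A segment of T that misses an end of each removed edge survives the switch, so together
  -- with a new edge joining its ends it would form a cycle of the switched tree.
  surviving-segment-closed⇒no-interior :
    ∀ {x y} mid → IsPath (Adj T) (x ∷ mid ++ y ∷ []) →
    MissesAnEnd a b (x ∷ mid ++ y ∷ []) → MissesAnEnd c d (x ∷ mid ++ y ∷ []) →
    switchAdj T a b c d y x → mid ≡ []
  surviving-segment-closed⇒no-interior mid (l , uniq) mab mcd yx =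
    Acyclic.closed-path⇒no-interior switch-acyclic mid (Linked-switch⁺ _ mab mcd l , uniq) yx

  a≢b : a ≢ b
  a≢b refl = Graph.irrefl T ab

  c≢d : c ≢ d
  c≢d refl = Graph.irrefl T cd

  through-b-and-c : ∀ ms → IsPath (Adj T) (a ∷ b ∷ ms ++ d ∷ []) → c ∈ ms →
                    Σ (List (Fin n)) λ mid → IsPath (Adj T) (a ∷ b ∷ mid ++ c ∷ d ∷ [])
  through-b-and-c ms p c∈
    with neighbour-on-path-is-penultimate ms (IsPath-++⁻ʳ (a ∷ []) p) (Graph.sym T cd) c∈
  ... | ms′ , refl =
    ms′ , subst (λ K → IsPath (Adj T) (a ∷ b ∷ K)) (++-assoc ms′ (c ∷ []) (d ∷ [])) p

  through-b : ∀ mid → IsPath (Adj T) (a ∷ mid ++ d ∷ []) → b ∈ mid → Aligned T a b c d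
  through-b mid p b∈
    with neighbour-on-path-is-next mid (IsPath-++⁻ˡ (a ∷ mid) p) (Graph.sym T ab) b∈
  ... | ms , refl with c ∈? ms
  ...   | yes c∈ = inj₁ (through-b-and-c ms p c∈)
  ...   | no c∉
    with surviving-segment-closed⇒no-interior ms (IsPath-++⁻ʳ (a ∷ []) p)
           (inj₁ (Uniqueₚ.Unique[x∷xs]⇒x∉xs (proj₂ p)))
           (inj₁ (∉-∷⁺ (b≢c ∘ sym) (∉-++⁺ ms c∉ (∉-∷⁺ c≢d λ ()))))
           (inj₂ (inj₂ (inj₂ (refl , refl))))
  ...     | refl = ⊥-elim (¬bd (Linked.head (Linked.tail (proj₁ p))))

  through-c-not-b : ∀ mid → IsPath (Adj T) (a ∷ mid ++ d ∷ []) → b ∉ mid → c ∉ mid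
  through-c-not-b mid p b∉ c∈ with neighbour-on-path-is-penultimate mid p (Graph.sym T cd) c∈
  ... | ys , refl
    with surviving-segment-closed⇒no-interior ys (IsPath-++⁻ˡ (a ∷ ys ++ c ∷ []) p)
           (inj₂ (∉-∷⁺ (a≢b ∘ sym) b∉))
           (inj₂ (Unique-∷ʳ⁻ (a ∷ ys ++ c ∷ []) (proj₂ p)))
           (inj₂ (inj₁ (inj₂ (refl , refl))))
  ...   | refl = ¬ac (Linked.head (proj₁ p))

  avoiding-b-and-c : ∀ mid → IsPath (Adj T) (a ∷ mid ++ d ∷ []) → b ∉ mid → c ∉ mid →
                     IsPath (Adj T) (b ∷ a ∷ mid ++ d ∷ c ∷ [])
  avoiding-b-and-c mid p b∉mid c∉mid =
    IsPath-∷⁺ (Graph.sym T ab) b∉ (IsPath-∷ʳ⁺ (a ∷ mid) p (Graph.sym T cd) c∉)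
    where
      b∉ : b ∉ a ∷ mid ++ d ∷ c ∷ []
      b∉ = ∉-∷⁺ (a≢b ∘ sym) (∉-++⁺ mid b∉mid (∉-∷⁺ b≢d (∉-∷⁺ b≢c λ ())))
      c∉ : c ∉ a ∷ mid ++ d ∷ []
      c∉ = ∉-∷⁺ (a≢c ∘ sym) (∉-++⁺ mid c∉mid (∉-∷⁺ c≢d λ ()))

  aligned : Aligned T a b c d
  aligned with proj₁ tree a d
  ... | inj₁ a≡d = ⊥-elim (a≢d a≡d)
  ... | inj₂ (mid , p) with b ∈? mid | c ∈? mid
  ...   | yes b∈ | _      = through-b mid p b∈
  ...   | no b∉  | yes c∈ = ⊥-elim (through-c-not-b mid p b∉ c∈)
  ...   | no b∉  | no c∉  = inj₂ (mid , avoiding-b-and-c mid p b∉ c∉)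

theorem3 : ∀ {n} (T : Graph n) → IsTree T → (a b c d : Fin n) →
    Adj T a b → Adj T c d →
    ¬ a ≡ c → ¬ a ≡ d → ¬ b ≡ c → ¬ b ≡ d →
    IsTSwitch T a b c d ⇔
      ((Σ (List (Fin n)) λ mid → IsPath (Adj T) (a ∷ b ∷ mid ++ c ∷ d ∷ []))
      ⊎ (Σ (List (Fin n)) λ mid → IsPath (Adj T) (b ∷ a ∷ mid ++ d ∷ c ∷ [])))
theorem3 T tree a b c d ab cd a≢c a≢d b≢c b≢d = mk⇔ aligned is-t-switch
  where
    aligned : IsTSwitch T a b c d → Aligned T a b c d
    aligned ((_ , _ , _ , _ , _ , _ , ¬ac , ¬bd) , _ , switch-acyclic) =
      AlignedFromAcyclicSwitch.aligned T tree ab cd a≢c a≢d b≢c b≢d ¬ac ¬bd switch-acyclic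

    is-t-switch : Aligned T a b c d → IsTSwitch T a b c d
    is-t-switch (inj₁ (mid , p)) =
      SwitchAlongAlignedRoute.is-t-switch T tree ab cd a≢c a≢d b≢c b≢d mid p
    is-t-switch (inj₂ (mid , p)) = IsTSwitch-flip T a b c d
      (SwitchAlongAlignedRoute.is-t-switch T tree (Graph.sym T ab) (Graph.sym T cd)
         b≢d b≢c a≢d a≢c mid p)
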